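{- Let $G$ be a graph. Then $G$ is precedence $2$-thin if and only if there exist orderings $s_1,s_2$ of two sets $V(s_1),V(s_2)$ forming a bipartition $(V(s_1),V(s_2))$ of $V(G)$ such that the concatenation $s=s_1s_2$ is consistent with this bipartition and $(s_1,s_2)$ is in accordance with $G$.
   Context: An ordering $s$ of $V(G)$ is consistent with a partition $(V_1,\ldots,V_k)$ if for every triple $p,q,r$ with $p$ before $q$ before $r$ in $s$, whenever $p,q$ lie in the same part and $(p,r)\in E(G)$, then $(q,r)\in E(G)$. $G$ is precedence $k$-thin if there is a partition of $V(G)$ into $k$ parts and an ordering consistent with it in which each part is consecutive. An ordering of $V(H)$ is canonical if for all $p$ before $q$ before $r$, $(p,r)\in E(H)$ implies $(q,r)\in E(H)$. For a bipartition $(A,B)$ of $V(G)$, $S_G(A,B)$ is the split graph obtained from $G$ by adding all edges between vertices of $A$ and removing all edges between vertices of $B$. An ordering of $A$ is a threshold ordering of $S_G(A,B)$ if whenever $u$ precedes $v$ in it, $N[u]\subseteq N[v]$ in $S_G(A,B)$; an ordering of $B$ is a threshold ordering of $S_G(A,B)$ if whenever $u$ precedes $v$, $N(u)\subseteq N(v)$ in $S_G(A,B)$. The pair $(s_1,s_2)$ is in accordance with $G$ if $s_1$ is a threshold ordering of $S_G(V(s_1),V(s_2))$ and $s_1$, $s_2$ are canonical orderings of $G[V(s_1)]$ and $G[V(s_2)]$ respectively. -}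

module Defs where

open import Data.Nat using (ℕ)
open import Data.Fin using (Fin) renaming (_<_ to _<ᶠ_)
open import Data.List using (List; length; lookup; _++_)
open import Data.List.Membership.Propositional using (_∈_)
open import Data.List.Relation.Unary.Unique.Propositional using (Unique)
open import Data.Product using (Σ; _×_; ∃)
open import Data.Sum using (_⊎_)
open import Relation.Binary.PropositionalEquality using (_≡_)
open import Relation.Nullary using (¬_)

record Graph : Set₁ where
  field
    n      : ℕ
    E      : Fin n → Fin n → Set
    sym    : ∀ {u v} → E u v → E v u
    irrefl : ∀ {u} → ¬ E u u

open Graph public

module _ (G : Graph) where
  V : Set
  V = Fin (n G)

  -- An ordering of a set of vertices: a duplicate-free list.
  -- p precedes q in s.
  Before : List V → V → V → Set
  Before s p q = Σ (Fin (length s)) λ i → Σ (Fin (length s)) λ j →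
                   (i <ᶠ j) × (lookup s i ≡ p) × (lookup s j ≡ q)

  IsOrderingOfV : List V → Set
  IsOrderingOfV s = Unique s × (∀ v → v ∈ s)

  ConsistentWith : List V → (V → V → Set) → Set
  ConsistentWith s same = ∀ p q r → Before s p q → Before s q r →
                          same p q → E G p r → E G q r

  PartsConsecutive : List V → (V → V → Set) → Set
  PartsConsecutive s same = ∀ p q r → Before s p q → Before s q r →
                            same p r → same p q

  -- Partition into k parts (given by a labelling V → Fin k; parts may be empty).
  SamePart : {k : ℕ} → (V → Fin k) → V → V → Set
  SamePart part p q = part p ≡ part q

  PrecedenceThin : ℕ → Set
  PrecedenceThin k = Σ (V → Fin k) λ part → Σ (List V) λ s →
    IsOrderingOfV s × ConsistentWith s (SamePart part)
                    × PartsConsecutive s (SamePart part)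

  Canonical : List V → Set
  Canonical s = ∀ p q r → Before s p q → Before s q r → E G p r → E G q r

  -- adjacency in the split graph S_G(A,B) (A,B given as lists forming a bipartition)
  SplitAdj : List V → List V → V → V → Set
  SplitAdj A B x y = ¬ (x ≡ y) ×
    ((x ∈ A × y ∈ A) ⊎ (x ∈ A × y ∈ B × E G x y) ⊎ (x ∈ B × y ∈ A × E G x y))

  ClosedNbhd : List V → List V → V → V → Set
  ClosedNbhd A B u w = (w ≡ u) ⊎ SplitAdj A B u w

  -- s₁ is a threshold ordering of S_G(V(s₁),V(s₂))
  ThresholdA : List V → List V → Set
  ThresholdA s₁ s₂ = ∀ u v → Before s₁ u v →
                     ∀ w → ClosedNbhd s₁ s₂ u w → ClosedNbhd s₁ s₂ v w

  InAccordance : List V → List V → Set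
  InAccordance s₁ s₂ = ThresholdA s₁ s₂ × Canonical s₁ × Canonical s₂

  SameSide : List V → List V → V → V → Set
  SameSide s₁ s₂ p q = (p ∈ s₁ × q ∈ s₁) ⊎ (p ∈ s₂ × q ∈ s₂)

-- An ordering s witnessing precedence 2-thinness has consecutive parts, so it
-- splits as s = s₁ ++ s₂ with each block inside one part: s₁ is the maximal
-- prefix lying in the part of the first vertex, and once an ordering with
-- consecutive parts leaves a part it never returns to it.  Conversely a
-- concatenation s₁ ++ s₂ of an ordering of V(G) makes "membership in s₁" a
-- 2-labelling whose parts are consecutive.
--
-- It then shows that an ordering
-- consistent with a partition in which both blocks lie inside single parts is
-- consistent with the bipartition (V(s₁),V(s₂)) and in accordance with G:
-- canonicity of each block and the threshold property of s₁ are instances of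
-- the consistency condition.
module Submission where

open import Defs
open import Data.Empty using (⊥; ⊥-elim)
open import Data.Fin using (Fin; zero; suc; _≟_)
open import Data.List using (List; []; _∷_; _++_; length; lookup; takeWhile; dropWhile; head)
open import Data.List.Properties using (takeWhile++dropWhile)
open import Data.List.Membership.Propositional using (_∈_; _∉_)
open import Data.List.Membership.Propositional.Properties using (∈-lookup; ∈-++⁺ˡ; ∈-++⁺ʳ; ∈-++⁻)
import Data.List.Membership.DecPropositional as DecMembership
open import Data.List.Relation.Unary.Any as Any using (here; there)
open import Data.List.Relation.Unary.Any.Properties using (lookup-index)
open import Data.List.Relation.Unary.All as All using (All; []; _∷_)
open import Data.List.Relation.Unary.All.Properties using (all-takeWhile; all-head-dropWhile)
open import Data.List.Relation.Unary.AllPairs using (_∷_)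
open import Data.List.Relation.Unary.Unique.Propositional using (Unique)
import Data.Maybe.Relation.Unary.All as Maybe
open import Data.Nat using (s≤s; z≤n)
open import Data.Product using (Σ; _×_; _,_)
open import Data.Sum using (_⊎_; inj₁; inj₂)
open import Function.Bundles using (_⇔_; mk⇔)
open import Relation.Nullary using (Dec; yes; no)
open import Relation.Binary.PropositionalEquality as ≡ using (_≡_; _≢_; refl; subst)

module _ (G : Graph) where

  position : ∀ {s : List (V G)} {q} → q ∈ s → Σ (Fin (length s)) λ j → lookup s j ≡ q
  position q∈s = Any.index q∈s , ≡.sym (lookup-index q∈s)

  before-∷ : ∀ {x s p q} → Before G s p q → Before G (x ∷ s) p q
  before-∷ (i , j , i<j , at-i , at-j) = suc i , suc j , s≤s i<j , at-i , at-j

  before-head : ∀ {x s q} → q ∈ s → Before G (x ∷ s) x q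
  before-head q∈s with position q∈s
  ... | j , at-j = zero , suc j , s≤s z≤n , refl , at-j

  before-∷-cases : ∀ {x s p q} → Before G (x ∷ s) p q →
                   (p ≡ x × q ∈ s) ⊎ Before G s p q
  before-∷-cases (zero , zero , () , _)
  before-∷-cases {s = s} (zero , suc j , _ , at-i , at-j) =
    inj₁ (≡.sym at-i , subst (_∈ s) at-j (∈-lookup j))
  before-∷-cases (suc i , zero , () , _)
  before-∷-cases (suc i , suc j , s≤s i<j , at-i , at-j) = inj₂ (i , j , i<j , at-i , at-j)

  before-∈ˡ : ∀ {s p q} → Before G s p q → p ∈ s
  before-∈ˡ {s} (i , _ , _ , at-i , _) = subst (_∈ s) at-i (∈-lookup i)

  before-∈ʳ : ∀ {s p q} → Before G s p q → q ∈ s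
  before-∈ʳ {s} (_ , j , _ , _ , at-j) = subst (_∈ s) at-j (∈-lookup j)

  before-++ˡ : ∀ s₁ s₂ {p q} → Before G s₁ p q → Before G (s₁ ++ s₂) p q
  before-++ˡ [] s₂ (() , _)
  before-++ˡ (x ∷ s₁) s₂ pq with before-∷-cases pq
  ... | inj₁ (refl , q∈s₁) = before-head (∈-++⁺ˡ q∈s₁)
  ... | inj₂ pq′ = before-∷ (before-++ˡ s₁ s₂ pq′)

  before-++ʳ : ∀ s₁ s₂ {p q} → Before G s₂ p q → Before G (s₁ ++ s₂) p q
  before-++ʳ [] s₂ pq = pq
  before-++ʳ (x ∷ s₁) s₂ pq = before-∷ (before-++ʳ s₁ s₂ pq)

  before-across : ∀ s₁ s₂ {p q} → p ∈ s₁ → q ∈ s₂ → Before G (s₁ ++ s₂) p q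
  before-across (x ∷ s₁) s₂ (here refl) q∈s₂ = before-head (∈-++⁺ʳ s₁ q∈s₂)
  before-across (x ∷ s₁) s₂ (there p∈s₁) q∈s₂ = before-∷ (before-across s₁ s₂ p∈s₁ q∈s₂)

  before-asym : ∀ {s p q} → Unique s → Before G s p q → Before G s q p → ⊥
  before-asym {[]} _ (() , _)
  before-asym {x ∷ s} (x∉s ∷ u) pq qp with before-∷-cases pq | before-∷-cases qp
  ... | inj₁ (refl , q∈s) | inj₁ (q≡x , _) = All.lookup x∉s q∈s (≡.sym q≡x)
  ... | inj₁ (refl , _)   | inj₂ qp′       = All.lookup x∉s (before-∈ʳ qp′) refl
  ... | inj₂ pq′          | inj₁ (refl , _) = All.lookup x∉s (before-∈ʳ pq′) refl
  ... | inj₂ pq′          | inj₂ qp′       = before-asym u pq′ qp′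

  consistent-mono : ∀ {s} {same same′ : V G → V G → Set} →
                    (∀ {p q} → same′ p q → same p q) →
                    ConsistentWith G s same → ConsistentWith G s same′
  consistent-mono finer cons p q r pq qr pq-same = cons p q r pq qr (finer pq-same)

  InOnePart : (V G → V G → Set) → List (V G) → Set
  InOnePart same t = ∀ {x y} → x ∈ t → y ∈ t → same x y

  canonical-in-part : ∀ {s t same} → (∀ {p q} → Before G t p q → Before G s p q) →
                      InOnePart same t → ConsistentWith G s same → Canonical G t
  canonical-in-part embed one cons p q r pq qr pr =
    cons p q r (embed pq) (embed qr) (one (before-∈ˡ pq) (before-∈ʳ pq)) pr

  -- If the first block lies inside one part of a consistent ordering
  -- s₁ ++ s₂, then s₁ is a threshold ordering of S_G(V(s₁),V(s₂)): inside s₁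
  -- the split graph is complete, and an edge from u to w ∈ s₂ passes to every
  -- later v ∈ s₁ by consistency applied to u, v, w.
  threshold-first-block : ∀ {s₁ s₂ same} → InOnePart same s₁ →
                          ConsistentWith G (s₁ ++ s₂) same → ThresholdA G s₁ s₂
  threshold-first-block {s₁} {s₂} one cons u v uv w = closed
    where
    v∈s₁ : v ∈ s₁
    v∈s₁ = before-∈ʳ uv

    within-A : w ∈ s₁ → ClosedNbhd G s₁ s₂ v w
    within-A w∈s₁ with w ≟ v
    ... | yes w≡v = inj₁ w≡v
    ... | no w≢v = inj₂ ((λ v≡w → w≢v (≡.sym v≡w)) , inj₁ (v∈s₁ , w∈s₁))

    closed : ClosedNbhd G s₁ s₂ u w → ClosedNbhd G s₁ s₂ v w
    closed (inj₁ refl) = within-A (before-∈ˡ uv)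
    closed (inj₂ (_ , inj₁ (_ , w∈s₁))) = within-A w∈s₁
    closed (inj₂ (_ , inj₂ (inj₂ (_ , w∈s₁ , _)))) = within-A w∈s₁
    closed (inj₂ (_ , inj₂ (inj₁ (u∈s₁ , w∈s₂ , uw)))) =
      inj₂ ((λ { refl → irrefl G vw }) , inj₂ (inj₁ (v∈s₁ , w∈s₂ , vw)))
      where
      vw : E G v w
      vw = cons u v w (before-++ˡ s₁ s₂ uv) (before-across s₁ s₂ v∈s₁ w∈s₂)
                (one u∈s₁ v∈s₁) uw

  blocks⇒accordance : ∀ {s₁ s₂ same} → InOnePart same s₁ → InOnePart same s₂ →
                      ConsistentWith G (s₁ ++ s₂) same →
                      ConsistentWith G (s₁ ++ s₂) (SameSide G s₁ s₂) × InAccordance G s₁ s₂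
  blocks⇒accordance {s₁} {s₂} {same} one₁ one₂ cons =
    consistent-mono {s₁ ++ s₂} side⇒same cons ,
    threshold-first-block one₁ cons ,
    canonical-in-part {s₁ ++ s₂} {s₁} (before-++ˡ s₁ s₂) one₁ cons ,
    canonical-in-part {s₁ ++ s₂} {s₂} (before-++ʳ s₁ s₂) one₂ cons
    where
    side⇒same : ∀ {p q} → SameSide G s₁ s₂ p q → same p q
    side⇒same (inj₁ (p∈ , q∈)) = one₁ p∈ q∈
    side⇒same (inj₂ (p∈ , q∈)) = one₂ p∈ q∈

  rest-outside : ∀ {k} (part : V G → Fin k) (pre rest : List (V G)) {p} →
                 PartsConsecutive G (pre ++ rest) (SamePart G part) → p ∈ pre →
                 Maybe.All (λ y → part y ≢ part p) (head rest) →
                 All (λ x → part x ≢ part p) rest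
  rest-outside part pre [] _ _ _ = []
  rest-outside part pre (y ∷ r) {p} consec p∈pre (Maybe.just y-outside) =
    y-outside ∷ All.tabulate later-outside
    where
    later-outside : ∀ {x} → x ∈ r → part x ≢ part p
    later-outside x∈r x-inside =
      y-outside (≡.sym (consec p y _ (before-across pre (y ∷ r) p∈pre (here refl))
                                     (before-++ʳ pre (y ∷ r) (before-head x∈r))
                                     (≡.sym x-inside)))

  head-∈-takeWhile : ∀ {P : V G → Set} (P? : ∀ x → Dec (P x)) {x xs} →
                     P x → x ∈ takeWhile P? (x ∷ xs)
  head-∈-takeWhile P? {x} Px with P? x
  ... | yes _ = here refl
  ... | no ¬Px = ⊥-elim (¬Px Px)

  avoid-same : {a b c : Fin 2} → a ≢ c → b ≢ c → a ≡ b
  avoid-same {zero}     {zero}     _   _   = refl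
  avoid-same {suc zero} {suc zero} _   _   = refl
  avoid-same {zero}     {suc zero} {zero}     a≢c _ = ⊥-elim (a≢c refl)
  avoid-same {zero}     {suc zero} {suc zero} _ b≢c = ⊥-elim (b≢c refl)
  avoid-same {suc zero} {zero}     {zero}     _ b≢c = ⊥-elim (b≢c refl)
  avoid-same {suc zero} {zero}     {suc zero} a≢c _ = ⊥-elim (a≢c refl)

  consecutive⇒two-blocks : (part : V G → Fin 2) (s : List (V G)) →
    PartsConsecutive G s (SamePart G part) →
    Σ (List (V G)) λ s₁ → Σ (List (V G)) λ s₂ →
      (s₁ ++ s₂ ≡ s) × InOnePart (SamePart G part) s₁ × InOnePart (SamePart G part) s₂
  consecutive⇒two-blocks part [] _ = [] , [] , refl , (λ ()) , (λ ())
  consecutive⇒two-blocks part s@(h ∷ t) consec =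
    takeWhile P? s , dropWhile P? s , split , prefix-one , rest-one
    where
    P? : ∀ x → Dec (part x ≡ part h)
    P? x = part x ≟ part h

    split : takeWhile P? s ++ dropWhile P? s ≡ s
    split = takeWhile++dropWhile P? s

    prefix-one : InOnePart (SamePart G part) (takeWhile P? s)
    prefix-one x∈ y∈ = ≡.trans (All.lookup (all-takeWhile P? s) x∈)
                               (≡.sym (All.lookup (all-takeWhile P? s) y∈))

    rest-avoids : All (λ x → part x ≢ part h) (dropWhile P? s)
    rest-avoids = rest-outside part (takeWhile P? s) (dropWhile P? s)
      (subst (λ s′ → PartsConsecutive G s′ (SamePart G part)) (≡.sym split) consec)
      (head-∈-takeWhile P? refl) (all-head-dropWhile P? s)

    rest-one : InOnePart (SamePart G part) (dropWhile P? s)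
    rest-one x∈ y∈ = avoid-same (All.lookup rest-avoids x∈) (All.lookup rest-avoids y∈)

  open DecMembership (_≟_ {n G}) using (_∈?_)

  side : List (V G) → V G → Fin 2
  side s₁ x with x ∈? s₁
  ... | yes _ = zero
  ... | no _ = suc zero

  ∉-first⇒∈-second : ∀ (s₁ s₂ : List (V G)) {x} → x ∈ s₁ ++ s₂ → x ∉ s₁ → x ∈ s₂
  ∉-first⇒∈-second s₁ s₂ x∈ x∉s₁ with ∈-++⁻ s₁ x∈
  ... | inj₁ x∈s₁ = ⊥-elim (x∉s₁ x∈s₁)
  ... | inj₂ x∈s₂ = x∈s₂

  before-first⇒first : ∀ (s₁ s₂ : List (V G)) {p q} → Unique (s₁ ++ s₂) →
                       Before G (s₁ ++ s₂) p q → q ∈ s₁ → p ∈ s₁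
  before-first⇒first s₁ s₂ {p} u pq q∈s₁ with p ∈? s₁
  ... | yes p∈s₁ = p∈s₁
  ... | no p∉s₁ = ⊥-elim (before-asym u pq
          (before-across s₁ s₂ q∈s₁ (∉-first⇒∈-second s₁ s₂ (before-∈ˡ pq) p∉s₁)))

  same-label⇒same-side : ∀ (s₁ s₂ : List (V G)) {p q} → (∀ v → v ∈ s₁ ++ s₂) →
                         side s₁ p ≡ side s₁ q → SameSide G s₁ s₂ p q
  same-label⇒same-side s₁ s₂ {p} {q} covers same-label with p ∈? s₁ | q ∈? s₁
  same-label⇒same-side s₁ s₂ covers refl | yes p∈ | yes q∈ = inj₁ (p∈ , q∈)
  same-label⇒same-side s₁ s₂ covers ()   | yes _  | no _
  same-label⇒same-side s₁ s₂ covers ()   | no _   | yes _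
  same-label⇒same-side s₁ s₂ {p} {q} covers refl | no p∉ | no q∉ =
    inj₂ (∉-first⇒∈-second s₁ s₂ (covers p) p∉ , ∉-first⇒∈-second s₁ s₂ (covers q) q∉)

  sides-consecutive : ∀ (s₁ s₂ : List (V G)) → Unique (s₁ ++ s₂) →
                      PartsConsecutive G (s₁ ++ s₂) (SamePart G (side s₁))
  sides-consecutive s₁ s₂ u p q r pq qr same-pr with p ∈? s₁ | q ∈? s₁ | r ∈? s₁
  ... | yes _ | yes _ | _ = refl
  ... | no _  | no _  | _ = refl
  ... | yes _ | no q∉ | yes r∈ = ⊥-elim (q∉ (before-first⇒first s₁ s₂ u qr r∈))
  ... | no p∉ | yes q∈ | _ = ⊥-elim (p∉ (before-first⇒first s₁ s₂ u pq q∈))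
  sides-consecutive s₁ s₂ u p q r pq qr () | yes _ | no _ | no _

  AccordantBlocks : Set
  AccordantBlocks = Σ (List (V G)) λ s₁ → Σ (List (V G)) λ s₂ →
    IsOrderingOfV G (s₁ ++ s₂)
    × ConsistentWith G (s₁ ++ s₂) (SameSide G s₁ s₂)
    × InAccordance G s₁ s₂

  thin⇒accordant-blocks : PrecedenceThin G 2 → AccordantBlocks
  thin⇒accordant-blocks (part , s , ordering , cons , consec)
    with consecutive⇒two-blocks part s consec
  ... | s₁ , s₂ , refl , one₁ , one₂ =
    s₁ , s₂ , ordering , blocks⇒accordance {same = SamePart G part} one₁ one₂ cons

  accordant-blocks⇒thin : AccordantBlocks → PrecedenceThin G 2
  accordant-blocks⇒thin (s₁ , s₂ , ordering@(unique , covers) , cons , _) =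
    side s₁ , s₁ ++ s₂ , ordering ,
    consistent-mono {s₁ ++ s₂} (same-label⇒same-side s₁ s₂ covers) cons ,
    sides-consecutive s₁ s₂ unique

lemma3 : (G : Graph) →
    PrecedenceThin G 2 ⇔
    Σ (List (V G)) λ s₁ → Σ (List (V G)) λ s₂ →
      IsOrderingOfV G (s₁ ++ s₂)
      × ConsistentWith G (s₁ ++ s₂) (SameSide G s₁ s₂)
      × InAccordance G s₁ s₂
lemma3 G = mk⇔ (thin⇒accordant-blocks G) (accordant-blocks⇒thin G)
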